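{- Let $G$ be a finite simple graph and $T$ its toll walk transit function. Then $T$ satisfies Axioms (JC) and (pt) on $G$ if and only if $G$ is a Ptolemaic graph.
   Context: In a finite simple graph $G$, a walk $W=w_1w_2\cdots w_k$ ($k\ge 2$) is a toll walk if $w_1\neq w_k$, $w_2$ is the only neighbor of $w_1$ among the vertices of $W$, and $w_{k-1}$ is the only neighbor of $w_k$ among the vertices of $W$. The toll walk transit function $T$ of $G$ is given by $T(u,u)=\{u\}$ and, for $u\ne v$, $T(u,v)$ is the set of all vertices lying on some toll walk from $u$ to $v$. A graph is chordal if it has no induced cycle of length at least four; distance-hereditary if every induced path is a shortest path; Ptolemaic if it is both chordal and distance-hereditary (for connected graphs, equivalently, $d(u,v)d(w,x)+d(u,x)d(v,w)\ge d(u,w)d(v,x)$ for all vertices $u,v,w,x$). Axioms for $R=T$ on $V=V(G)$: (JC) For pairwise distinct $u,x,y,v$: if $x\in R(u,y)$, $y\in R(x,v)$ and $R(x,y)=\{x,y\}$, then $x\in R(u,v)$. (pt) For pairwise distinct $u,x,y,z,v$: if $x,z\in R(u,y)$, $y,z\in R(x,v)$ and $R(x,y)=\{x,y\}$, then $R(x,z)\neq\{x,z\}$ and $R(y,z)\neq\{y,z\}$. -}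

module Defs where

open import Data.Nat using (ℕ; zero; suc; _+_; _≤_; _%_)
open import Data.Bool using (Bool; true; false)
open import Data.Fin using (Fin; zero; suc; toℕ; fromℕ; inject₁)
open import Data.Product using (Σ; _×_; _,_; ∃)
open import Data.Sum using (_⊎_)
open import Relation.Binary.PropositionalEquality using (_≡_; _≢_)
open import Relation.Nullary using (¬_)
open import Function.Definitions using (Injective)
open import Function.Bundles using (_⇔_)

record Graph : Set where
  field
    n     : ℕ
    adj   : Fin n → Fin n → Bool
    sym   : ∀ u v → adj u v ≡ adj v u
    irrefl : ∀ u → adj u u ≡ false

module _ (G : Graph) where
  open Graph G

  V : Set
  V = Fin n

  Adj : V → V → Set
  Adj u v = adj u v ≡ true

  IsWalk : (ℓ : ℕ) → (Fin (suc ℓ) → V) → Set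
  IsWalk ℓ w = ∀ (i : Fin ℓ) → Adj (w (inject₁ i)) (w (suc i))

  -- a toll walk from u to v with vertices w_1 … w_k, k = ℓ + 2 ≥ 2
  -- (k ≥ 2 is forced by u ≢ v);  w_1 = w zero, w_2 = w (suc zero),
  -- w_{k-1} = w (inject₁ (fromℕ ℓ)), w_k = w (fromℕ (suc ℓ)).
  IsTollWalk : V → V → (ℓ : ℕ) → (Fin (suc (suc ℓ)) → V) → Set
  IsTollWalk u v ℓ w =
    u ≢ v × w zero ≡ u × w (fromℕ (suc ℓ)) ≡ v × IsWalk (suc ℓ) w
    × (∀ j → Adj u (w j) → w j ≡ w (suc zero))
    × (∀ j → Adj v (w j) → w j ≡ w (inject₁ (fromℕ ℓ)))

  InT : V → V → V → Set
  InT u v x =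
    (u ≡ v × x ≡ u)
    ⊎ (u ≢ v × Σ ℕ λ ℓ → Σ (Fin (suc (suc ℓ)) → V) λ w →
         IsTollWalk u v ℓ w × ∃ λ j → w j ≡ x)

  IsPair : V → V → Set
  IsPair x y = ∀ z → InT x y z ⇔ (z ≡ x ⊎ z ≡ y)

  Axiom-JC : Set
  Axiom-JC = ∀ u x y v →
    u ≢ x → u ≢ y → u ≢ v → x ≢ y → x ≢ v → y ≢ v →
    InT u y x → InT x v y → IsPair x y → InT u v x

  Axiom-pt : Set
  Axiom-pt = ∀ u x y z v →
    u ≢ x → u ≢ y → u ≢ z → u ≢ v → x ≢ y → x ≢ z → x ≢ v →
    y ≢ z → y ≢ v → z ≢ v →
    InT u y x → InT u y z → InT x v y → InT x v z → IsPair x y →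
    ¬ IsPair x z × ¬ IsPair y z

  IsInducedCycle : (k : ℕ) → (Fin (4 + k) → V) → Set
  IsInducedCycle k c =
    Injective _≡_ _≡_ c
    × (∀ i j → toℕ j ≡ suc (toℕ i) % (4 + k) → Adj (c i) (c j))
    × (∀ i j → Adj (c i) (c j) →
         toℕ j ≡ suc (toℕ i) % (4 + k) ⊎ toℕ i ≡ suc (toℕ j) % (4 + k))

  Chordal : Set
  Chordal = ∀ k (c : Fin (4 + k) → V) → ¬ IsInducedCycle k c

  IsInducedPath : (k : ℕ) → (Fin (suc k) → V) → Set
  IsInducedPath k p =
    Injective _≡_ _≡_ p × IsWalk k p
    × (∀ i j → Adj (p i) (p j) → toℕ j ≡ suc (toℕ i) ⊎ toℕ i ≡ suc (toℕ j))

  IsShortest : (k : ℕ) → (Fin (suc k) → V) → Set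
  IsShortest k p = ∀ ℓ (w : Fin (suc ℓ) → V) → IsWalk ℓ w →
    w zero ≡ p zero → w (fromℕ ℓ) ≡ p (fromℕ k) → k ≤ ℓ

  DistanceHereditary : Set
  DistanceHereditary = ∀ k (p : Fin (suc k) → V) →
    IsInducedPath k p → IsShortest k p

  Ptolemaic : Set
  Ptolemaic = Chordal × DistanceHereditary

-- In a chordal graph a toll walk can be spliced along an edge: if x y is an edge, x lies on
-- a toll walk from u to y and y on one from x to v, then a neighbour of u or v on the spliced
-- walk u ⋯ x y ⋯ v would close a hole, which gives (JC). A failure of (pt) in a chordal graph
-- forces a triangle x y z, and in a distance-hereditary graph the induced path u ⋯ x y ⋯ v
-- would then be longer than the walk u ⋯ z ⋯ v.
-- Conversely, an induced 4-cycle violates (JC) and a longer hole violates (pt), so the graph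
-- is chordal. If p₀ p₁ p₂ ⋯ t is an induced path whose tail is geodesic but which is not, a
-- geodesic p₀ q₁ ⋯ t has q₁ adjacent to p₁ and p₂ by chordality, and (pt) fails for
-- u = p₀, x = p₁, y = p₂, z = q₁, v = t.

module Submission where

open import Defs
open import Data.Bool using (true)
open import Data.Bool.Properties using () renaming (_≟_ to _≟ᵇ_)
open import Data.Empty using (⊥; ⊥-elim)
open import Data.Fin as Fin using (Fin; zero; suc; toℕ; fromℕ; inject₁)
import Data.Fin.Properties as Finₚ
open import Data.List using (List; []; _∷_)
open import Data.List.Membership.Propositional using (_∈_; _∉_)
open import Data.List.Relation.Binary.Subset.Propositional using (_⊆_)
open import Data.List.Relation.Binary.Subset.Propositional.Properties using (⊆-trans; ∷⁺ʳ; xs⊆x∷xs)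
open import Data.List.Relation.Unary.Any as Any using (Any; here; there)
open import Data.Nat using (ℕ; zero; suc; _+_; _≤_; _<_; z≤n; s≤s; _%_)
open import Data.Nat.DivMod using (m<n⇒m%n≡m; n%n≡0)
import Data.Nat.Properties as ℕₚ
open import Data.Product using (Σ; ∃; _×_; _,_; proj₁; proj₂)
open import Data.Sum using (_⊎_; inj₁; inj₂; swap)
open import Data.Unit using (⊤; tt)
open import Function using (_∘_; id; case_of_; _⇔_; mk⇔; Equivalence)
open import Relation.Nullary using (¬_; Dec; yes; no)
open import Relation.Nullary.Decidable using (_⊎-dec_; _×-dec_)
open import Relation.Binary.PropositionalEquality

module _ (G : Graph) where

  open Graph G using (adj) renaming (sym to adj-sym; irrefl to adj-irrefl)

  infix 4 _~_
  _~_ : V G → V G → Set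
  _~_ = Adj G

  private variable
    a b c d t u v x y z : V G
    xs ys : List (V G)

  ~-sym : x ~ y → y ~ x
  ~-sym {x} {y} e = trans (sym (adj-sym x y)) e

  ~-irrefl : ¬ x ~ x
  ~-irrefl {x} e with trans (sym (adj-irrefl x)) e
  ... | ()

  ~⇒≢ : x ~ y → x ≢ y
  ~⇒≢ e refl = ~-irrefl e

  _~?_ : ∀ x y → Dec (x ~ y)
  x ~? y = adj x y ≟ᵇ true

  infixr 5 _◅_ _◅◅_

  data Walk : V G → V G → Set where
    ε   : Walk a a
    _◅_ : a ~ b → Walk b c → Walk a c

  vertices : Walk a b → List (V G)
  vertices (ε {a}) = a ∷ []
  vertices (_◅_ {a} _ w) = a ∷ vertices w

  length : Walk a b → ℕ
  length ε = 0
  length (_ ◅ w) = suc (length w)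

  head∈ : (w : Walk a b) → a ∈ vertices w
  head∈ ε = here refl
  head∈ (_ ◅ _) = here refl

  last∈ : (w : Walk a b) → b ∈ vertices w
  last∈ ε = here refl
  last∈ (_ ◅ w) = there (last∈ w)

  _◅◅_ : Walk a b → Walk b c → Walk a c
  ε ◅◅ w′ = w′
  (e ◅ w) ◅◅ w′ = e ◅ (w ◅◅ w′)

  length-◅◅ : (w : Walk a b) (w′ : Walk b c) → length (w ◅◅ w′) ≡ length w + length w′
  length-◅◅ ε w′ = refl
  length-◅◅ (e ◅ w) w′ = cong suc (length-◅◅ w w′)

  ∈-◅◅⁻ : (w : Walk a b) (w′ : Walk b c) → x ∈ vertices (w ◅◅ w′) → x ∈ vertices w ⊎ x ∈ vertices w′
  ∈-◅◅⁻ ε w′ x∈ = inj₂ x∈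
  ∈-◅◅⁻ (e ◅ w) w′ (here refl) = inj₁ (here refl)
  ∈-◅◅⁻ (e ◅ w) w′ (there x∈) with ∈-◅◅⁻ w w′ x∈
  ... | inj₁ x∈w = inj₁ (there x∈w)
  ... | inj₂ x∈w′ = inj₂ x∈w′

  ∈-◅◅⁺ˡ : (w : Walk a b) (w′ : Walk b c) → vertices w ⊆ vertices (w ◅◅ w′)
  ∈-◅◅⁺ˡ ε w′ (here refl) = head∈ w′
  ∈-◅◅⁺ˡ (e ◅ w) w′ (here refl) = here refl
  ∈-◅◅⁺ˡ (e ◅ w) w′ (there x∈) = there (∈-◅◅⁺ˡ w w′ x∈)

  ∈-◅◅⁺ʳ : (w : Walk a b) (w′ : Walk b c) → vertices w′ ⊆ vertices (w ◅◅ w′)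
  ∈-◅◅⁺ʳ ε w′ = id
  ∈-◅◅⁺ʳ (e ◅ w) w′ = there ∘ ∈-◅◅⁺ʳ w w′

  reverse : Walk a b → Walk b a
  reverse ε = ε
  reverse (e ◅ w) = reverse w ◅◅ ~-sym e ◅ ε

  ∈-reverse⁺ : (w : Walk a b) → vertices w ⊆ vertices (reverse w)
  ∈-reverse⁺ ε = id
  ∈-reverse⁺ (e ◅ w) (here refl) = ∈-◅◅⁺ʳ (reverse w) (~-sym e ◅ ε) (there (here refl))
  ∈-reverse⁺ (e ◅ w) (there x∈) = ∈-◅◅⁺ˡ (reverse w) (~-sym e ◅ ε) (∈-reverse⁺ w x∈)

  ∈-reverse⁻ : (w : Walk a b) → vertices (reverse w) ⊆ vertices w
  ∈-reverse⁻ ε = id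
  ∈-reverse⁻ (e ◅ w) x∈ with ∈-◅◅⁻ (reverse w) (~-sym e ◅ ε) x∈
  ... | inj₁ x∈w = there (∈-reverse⁻ w x∈w)
  ... | inj₂ (here refl) = there (head∈ w)
  ... | inj₂ (there (here refl)) = here refl

  splitAt : (w : Walk a b) → c ∈ vertices w →
            Σ (Walk a c) λ p → Σ (Walk c b) λ s →
              length p + length s ≡ length w × vertices p ⊆ vertices w × vertices s ⊆ vertices w
  splitAt ε (here refl) = ε , ε , refl , id , id
  splitAt (e ◅ w) (here refl) = ε , e ◅ w , refl , (λ { (here refl) → here refl }) , id
  splitAt (e ◅ w) (there c∈) with splitAt w c∈
  ... | p , s , len-ps , p⊆ , s⊆ = e ◅ p , s , cong suc len-ps , ∷⁺ʳ _ p⊆ , there ∘ s⊆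

  successor : (w : Walk a b) → x ∈ vertices w → x ≢ b → ∃ λ d → d ∈ vertices w × x ~ d
  successor ε (here refl) x≢b = ⊥-elim (x≢b refl)
  successor (e ◅ w) (here refl) x≢b = _ , there (head∈ w) , e
  successor (e ◅ w) (there x∈) x≢b with successor w x∈ x≢b
  ... | d , d∈ , x~d = d , there d∈ , x~d

  OnlyNeighbour : V G → V G → List (V G) → Set
  OnlyNeighbour x y xs = ∀ {d} → d ∈ xs → x ~ d → d ≡ y

  AtMostOneNeighbour : V G → List (V G) → Set
  AtMostOneNeighbour x xs = ∀ {c d} → c ∈ xs → d ∈ xs → x ~ c → x ~ d → c ≡ d

  onlyNeighbour⇒atMostOne : OnlyNeighbour x y xs → AtMostOneNeighbour x xs
  onlyNeighbour⇒atMostOne only c∈ d∈ x~c x~d = trans (only c∈ x~c) (sym (only d∈ x~d))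

  atMostOne-⊆ : xs ⊆ ys → AtMostOneNeighbour x ys → AtMostOneNeighbour x xs
  atMostOne-⊆ xs⊆ys one c∈ d∈ = one (xs⊆ys c∈) (xs⊆ys d∈)

  Induced : Walk a b → Set
  Induced ε = ⊤
  Induced (_◅_ {a} {b} _ w) = a ∉ vertices w × OnlyNeighbour a b (vertices w) × Induced w

  edge-induced : (e : x ~ y) → Induced (e ◅ ε)
  edge-induced e = (λ { (here refl) → ~-irrefl e }) , (λ { (here refl) _ → refl }) , tt

  Near : V G → V G → Set
  Near x y = x ≡ y ⊎ x ~ y

  near? : ∀ x y → Dec (Near x y)
  near? x y = (x Fin.≟ y) ⊎-dec (x ~? y)

  near⇒walk : Near a b → Σ (Walk b a) λ l → ∀ {d} → d ∈ vertices l → d ≡ b ⊎ d ≡ a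
  near⇒walk (inj₁ refl) = ε , λ { (here refl) → inj₁ refl }
  near⇒walk (inj₂ a~b) = ~-sym a~b ◅ ε , λ { (here refl) → inj₁ refl ; (there (here refl)) → inj₂ refl }

  private
    attach : ∀ x (p : Walk b t) → Induced p → Any (Near x) (vertices p) →
             Σ (Walk x t) λ q → Induced q × vertices q ⊆ x ∷ vertices p
    attach x ε _ (here (inj₁ refl)) = ε , tt , there
    attach x ε _ (here (inj₂ x~b)) = x~b ◅ ε , edge-induced x~b , id
    attach x (e ◅ p) (_ , _ , p-ind) near with Any.any? (near? x) (vertices p)
    ... | yes near-p with attach x p p-ind near-p
    ...   | q , q-ind , q⊆ = q , q-ind , ⊆-trans q⊆ (∷⁺ʳ x (xs⊆x∷xs _ _))
    attach x (e ◅ p) ep-ind (here (inj₁ refl)) | no _ = e ◅ p , ep-ind , there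
    attach x (e ◅ p) ep-ind (here (inj₂ x~b)) | no far =
      x~b ◅ e ◅ p ,
      ( (λ { (here refl) → ~-irrefl x~b ; (there x∈) → far (Any.map inj₁ x∈) })
      , (λ { (here refl) _ → refl ; (there d∈) x~d → ⊥-elim (far (Any.map (λ { refl → inj₂ x~d }) d∈)) })
      , ep-ind ) ,
      id
    attach x (e ◅ p) _ (there near-p) | no far = ⊥-elim (far near-p)

  shortcut : (w : Walk a b) → Σ (Walk a b) λ p → Induced p × vertices p ⊆ vertices w
  shortcut ε = ε , tt , id
  shortcut (_◅_ {a} e w) with shortcut w
  ... | p , p-ind , p⊆ with attach a p p-ind (Any.map (λ { refl → inj₂ e }) (head∈ p))
  ...   | q , q-ind , q⊆ = q , q-ind , ⊆-trans q⊆ (∷⁺ʳ a p⊆)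

  suffixAvoiding : (w : Walk a b) → y ∈ vertices w → x ≢ b → x ~ y → OnlyNeighbour x y (vertices w) →
                   Σ (Walk y b) λ s → vertices s ⊆ vertices w × x ∉ vertices s
  suffixAvoiding ε (here refl) x≢b x~y only = ε , id , λ { (here refl) → x≢b refl }
  suffixAvoiding {y = y} (e ◅ w) y∈ x≢b x~y only with Any.any? (y Fin.≟_) (vertices w)
  ... | yes y∈w with suffixAvoiding w y∈w x≢b x~y (only ∘ there)
  ...   | s , s⊆ , x∉s = s , there ∘ s⊆ , x∉s
  suffixAvoiding {y = y} {x} (e ◅ w) (here refl) x≢b x~y only | no y∉w =
    e ◅ w , id , λ { (here refl) → ~⇒≢ x~y refl ; (there x∈w) → x∉w x∈w }
    where
    -- the successor of x on w would be a neighbour of x other than y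
    x∉w : x ∉ vertices w
    x∉w x∈w with successor w x∈w x≢b
    ... | d , d∈ , x~d = y∉w (subst (_∈ vertices w) (only (there d∈) x~d) d∈)
  suffixAvoiding (e ◅ w) (there y∈w) x≢b x~y only | no y∉w = ⊥-elim (y∉w y∈w)

  inducedSuffix : (w : Walk a b) → AtMostOneNeighbour x (vertices w) → y ∈ vertices w → (e : x ~ y) → x ≢ b →
                  Σ (Walk y b) λ q → Induced (e ◅ q) × vertices q ⊆ vertices w
  inducedSuffix w one y∈ e x≢b with suffixAvoiding w y∈ x≢b e (λ d∈ x~d → one d∈ y∈ x~d e)
  ... | s , s⊆ , x∉s with shortcut s
  ... | q , q-ind , q⊆ = q , (x∉s ∘ q⊆ , (λ d∈ x~d → one (s⊆ (q⊆ d∈)) y∈ x~d e) , q-ind) , s⊆ ∘ q⊆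

  -- p extended by the vertex y is an induced path
  Induced▻ : Walk a x → V G → Set
  Induced▻ {x = x} p y = Induced p × y ∉ vertices p × OnlyNeighbour y x (vertices p)

  inducedPrefix : (w : Walk a b) → AtMostOneNeighbour y (vertices w) → x ∈ vertices w → x ~ y → y ≢ a →
                  Σ (Walk a x) λ p → Induced▻ p y × vertices p ⊆ vertices w
  inducedPrefix w one x∈ x~y y≢a
    with inducedSuffix (reverse w) (atMostOne-⊆ (∈-reverse⁻ w) one) (∈-reverse⁺ w x∈) (~-sym x~y) y≢a
  ... | q , (y∉q , only , _) , q⊆ with shortcut (reverse q)
  ... | p , p-ind , p⊆ =
    p , (p-ind , y∉q ∘ ∈-reverse⁻ q ∘ p⊆ , only ∘ ∈-reverse⁻ q ∘ p⊆) , ∈-reverse⁻ w ∘ q⊆ ∘ ∈-reverse⁻ q ∘ p⊆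

  induced-◅◅ : (p : Walk a b) (q : Walk b c) → Induced p → Induced q →
               (∀ {s t} → s ∈ vertices p → t ∈ vertices q → Near s t → s ≡ b ⊎ t ≡ b) → Induced (p ◅◅ q)
  induced-◅◅ ε q _ q-ind _ = q-ind
  induced-◅◅ {b = b} (_◅_ {a} {a⁺} e p) q (a∉p , only , p-ind) q-ind cross =
    a∉ , only′ , induced-◅◅ p q p-ind q-ind (λ s∈ → cross (there s∈))
    where
    a≢b : a ≢ b
    a≢b refl = a∉p (last∈ p)
    a∉ : a ∉ vertices (p ◅◅ q)
    a∉ a∈ with ∈-◅◅⁻ p q a∈
    ... | inj₁ a∈p = a∉p a∈p
    ... | inj₂ a∈q with cross (here refl) a∈q (inj₁ refl)
    ...   | inj₁ a≡b = a≢b a≡b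
    ...   | inj₂ refl = a≢b refl
    only′ : OnlyNeighbour a a⁺ (vertices (p ◅◅ q))
    only′ d∈ a~d with ∈-◅◅⁻ p q d∈
    ... | inj₁ d∈p = only d∈p a~d
    ... | inj₂ d∈q with cross (here refl) d∈q (inj₂ a~d)
    ...   | inj₁ a≡b = ⊥-elim (a≢b a≡b)
    ...   | inj₂ refl = only (last∈ p) a~d

  induced▻⇒induced : (p : Walk a x) (e : x ~ y) → Induced▻ p y → Induced (p ◅◅ e ◅ ε)
  induced▻⇒induced {x = x} p e (p-ind , y∉p , only-y) =
    induced-◅◅ p (e ◅ ε) p-ind (edge-induced e) cross
    where
    cross : ∀ {s t} → s ∈ vertices p → t ∈ vertices (e ◅ ε) → Near s t → s ≡ x ⊎ t ≡ x
    cross _ (here refl) _ = inj₂ refl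
    cross s∈ (there (here refl)) (inj₁ refl) = ⊥-elim (y∉p s∈)
    cross s∈ (there (here refl)) (inj₂ s~y) = inj₁ (only-y s∈ (~-sym s~y))

  -- The second vertex of w is a neighbour of u on w, so it is then u's only one.
  Toll : Walk u v → Set
  Toll {u} {v} w = AtMostOneNeighbour u (vertices w) × AtMostOneNeighbour v (vertices w)

  OnTollWalk : V G → V G → V G → Set
  OnTollWalk u v x = Σ (Walk u v) λ w → Toll w × x ∈ vertices w

  onTollWalk-sym : OnTollWalk u v x → OnTollWalk v u x
  onTollWalk-sym (w , (one-u , one-v) , x∈) =
    reverse w , (atMostOne-⊆ (∈-reverse⁻ w) one-v , atMostOne-⊆ (∈-reverse⁻ w) one-u) , ∈-reverse⁺ w x∈

  lookup : (w : Walk a b) → Fin (suc (length w)) → V G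
  lookup (ε {a}) _ = a
  lookup (_◅_ {a} _ w) zero = a
  lookup (_ ◅ w) (suc i) = lookup w i

  lookup-head : (w : Walk a b) → lookup w zero ≡ a
  lookup-head ε = refl
  lookup-head (_ ◅ _) = refl

  lookup-last : (w : Walk a b) → lookup w (fromℕ (length w)) ≡ b
  lookup-last ε = refl
  lookup-last (_ ◅ w) = lookup-last w

  lookup-∈ : (w : Walk a b) (i : Fin (suc (length w))) → lookup w i ∈ vertices w
  lookup-∈ ε i = here refl
  lookup-∈ (_ ◅ w) zero = here refl
  lookup-∈ (_ ◅ w) (suc i) = there (lookup-∈ w i)

  ∈⇒lookup : (w : Walk a b) → x ∈ vertices w → ∃ λ i → lookup w i ≡ x
  ∈⇒lookup ε (here refl) = zero , refl
  ∈⇒lookup (_ ◅ w) (here refl) = zero , refl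
  ∈⇒lookup (_ ◅ w) (there x∈) with ∈⇒lookup w x∈
  ... | i , refl = suc i , refl

  lookup-isWalk : (w : Walk a b) → IsWalk G (length w) (lookup w)
  lookup-isWalk (_◅_ {a} e w) zero = subst (a ~_) (sym (lookup-head w)) e
  lookup-isWalk (_ ◅ w) (suc i) = lookup-isWalk w i

  lookup-penultimate : (e : a ~ b) (w : Walk b c) → lookup (e ◅ w) (inject₁ (fromℕ (length w))) ~ c
  lookup-penultimate e ε = e
  lookup-penultimate _ (e ◅ w) = lookup-penultimate e w

  fromIsWalk : ∀ ℓ (f : Fin (suc ℓ) → V G) → IsWalk G ℓ f → Walk (f zero) (f (fromℕ ℓ))
  fromIsWalk zero f f-walk = ε
  fromIsWalk (suc ℓ) f f-walk = f-walk zero ◅ fromIsWalk ℓ (f ∘ suc) (f-walk ∘ suc)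

  length-fromIsWalk : ∀ ℓ f (f-walk : IsWalk G ℓ f) → length (fromIsWalk ℓ f f-walk) ≡ ℓ
  length-fromIsWalk zero f f-walk = refl
  length-fromIsWalk (suc ℓ) f f-walk = cong suc (length-fromIsWalk ℓ (f ∘ suc) (f-walk ∘ suc))

  ∈-fromIsWalk⁺ : ∀ ℓ f (f-walk : IsWalk G ℓ f) j → f j ∈ vertices (fromIsWalk ℓ f f-walk)
  ∈-fromIsWalk⁺ zero f f-walk zero = here refl
  ∈-fromIsWalk⁺ (suc ℓ) f f-walk zero = here refl
  ∈-fromIsWalk⁺ (suc ℓ) f f-walk (suc j) = there (∈-fromIsWalk⁺ ℓ (f ∘ suc) (f-walk ∘ suc) j)

  ∈-fromIsWalk⁻ : ∀ ℓ f (f-walk : IsWalk G ℓ f) → x ∈ vertices (fromIsWalk ℓ f f-walk) → ∃ λ j → f j ≡ x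
  ∈-fromIsWalk⁻ zero f f-walk (here refl) = zero , refl
  ∈-fromIsWalk⁻ (suc ℓ) f f-walk (here refl) = zero , refl
  ∈-fromIsWalk⁻ (suc ℓ) f f-walk (there x∈) with ∈-fromIsWalk⁻ ℓ (f ∘ suc) (f-walk ∘ suc) x∈
  ... | j , refl = suc j , refl

  InT⇒onTollWalk : u ≢ v → InT G u v x → OnTollWalk u v x
  InT⇒onTollWalk u≢v (inj₁ (u≡v , _)) = ⊥-elim (u≢v u≡v)
  InT⇒onTollWalk _ (inj₂ (_ , ℓ , f , (_ , refl , refl , f-walk , only-u , only-v) , j , refl)) =
    w , (onlyNeighbour⇒atMostOne (only only-u) , onlyNeighbour⇒atMostOne (only only-v)) ,
    ∈-fromIsWalk⁺ (suc ℓ) f f-walk j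
    where
    w = fromIsWalk (suc ℓ) f f-walk
    only : (∀ i → x ~ f i → f i ≡ y) → OnlyNeighbour x y (vertices w)
    only on-f c∈ x~c with ∈-fromIsWalk⁻ (suc ℓ) f f-walk c∈
    ... | i , refl = on-f i x~c

  onTollWalk⇒InT : u ≢ v → OnTollWalk u v x → InT G u v x
  onTollWalk⇒InT u≢v (ε , _) = ⊥-elim (u≢v refl)
  onTollWalk⇒InT {u} {v} u≢v (e ◅ w , (one-u , one-v) , x∈) =
    inj₂ (u≢v , length w , lookup (e ◅ w) ,
          (u≢v , refl , lookup-last w , lookup-isWalk (e ◅ w) , only-u , only-v) ,
          ∈⇒lookup (e ◅ w) x∈)
    where
    only-u : ∀ j → u ~ lookup (e ◅ w) j → lookup (e ◅ w) j ≡ lookup w zero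
    only-u j u~ = one-u (lookup-∈ (e ◅ w) j) (there (lookup-∈ w zero)) u~ (subst (u ~_) (sym (lookup-head w)) e)
    only-v : ∀ j → v ~ lookup (e ◅ w) j → lookup (e ◅ w) j ≡ lookup (e ◅ w) (inject₁ (fromℕ (length w)))
    only-v j v~ = one-v (lookup-∈ (e ◅ w) j) (lookup-∈ (e ◅ w) (inject₁ (fromℕ (length w)))) v~
                        (~-sym (lookup-penultimate e w))

  private
    closed-induced-trivial : (w : Walk a a) → Induced w → d ∈ vertices w → d ≡ a
    closed-induced-trivial ε _ (here refl) = refl
    closed-induced-trivial (e ◅ w) (a∉w , _) _ = ⊥-elim (a∉w (last∈ w))

  induced-last : (w : Walk a b) → Induced w → AtMostOneNeighbour b (vertices w)
  induced-last ε _ (here refl) (here refl) _ _ = refl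
  induced-last (e ◅ w) _ (here refl) (here refl) _ _ = refl
  induced-last {b = b} (e ◅ w) (_ , only , w-ind) (here refl) (there d∈) b~a b~d with only (last∈ w) (~-sym b~a)
  ... | refl = ⊥-elim (~-irrefl (subst (b ~_) (closed-induced-trivial w w-ind d∈) b~d))
  induced-last {b = b} (e ◅ w) (_ , only , w-ind) (there c∈) (here refl) b~c b~a with only (last∈ w) (~-sym b~a)
  ... | refl = ⊥-elim (~-irrefl (subst (b ~_) (closed-induced-trivial w w-ind c∈) b~c))
  induced-last (e ◅ w) (_ , _ , w-ind) (there c∈) (there d∈) = induced-last w w-ind c∈ d∈

  induced⇒toll : (w : Walk a b) → Induced w → Toll w
  induced⇒toll ε w-ind = (λ { (here refl) (here refl) _ _ → refl }) , induced-last ε w-ind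
  induced⇒toll (_◅_ {a} {a⁺} e w) w-ind@(_ , only , _) =
    onlyNeighbour⇒atMostOne only′ , induced-last (e ◅ w) w-ind
    where
    only′ : OnlyNeighbour a a⁺ (vertices (e ◅ w))
    only′ (here refl) a~a = ⊥-elim (~-irrefl a~a)
    only′ (there d∈) a~d = only d∈ a~d

  tollWalk-between-adjacent : (w : Walk x y) → Toll w → x ~ y → z ∈ vertices w → z ≡ x ⊎ z ≡ y
  tollWalk-between-adjacent {x} {y} w (one-x , one-y) x~y = go w id (inj₁ refl)
    where
    go : (s : Walk a b) → vertices s ⊆ vertices w → a ≡ x ⊎ a ≡ y → z ∈ vertices s → z ≡ x ⊎ z ≡ y
    go ε _ a≡ (here refl) = a≡
    go (_ ◅ _) _ a≡ (here refl) = a≡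
    go (e ◅ s) s⊆ (inj₁ refl) (there z∈) =
      go s (s⊆ ∘ there) (inj₂ (one-x (s⊆ (there (head∈ s))) (last∈ w) e x~y)) z∈
    go (e ◅ s) s⊆ (inj₂ refl) (there z∈) =
      go s (s⊆ ∘ there) (inj₁ (one-y (s⊆ (there (head∈ s))) (head∈ w) e (~-sym x~y))) z∈

  adj⇒isPair : x ~ y → IsPair G x y
  adj⇒isPair {x} {y} e z = mk⇔ to from
    where
    to : InT G x y z → z ≡ x ⊎ z ≡ y
    to z∈T with InT⇒onTollWalk (~⇒≢ e) z∈T
    ... | w , toll , z∈ = tollWalk-between-adjacent w toll e z∈
    toll = induced⇒toll (e ◅ ε) (edge-induced e)
    from : z ≡ x ⊎ z ≡ y → InT G x y z
    from (inj₁ refl) = onTollWalk⇒InT (~⇒≢ e) (e ◅ ε , toll , here refl)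
    from (inj₂ refl) = onTollWalk⇒InT (~⇒≢ e) (e ◅ ε , toll , there (here refl))

  isPair⇒adj : x ≢ y → IsPair G x y → x ~ y
  isPair⇒adj x≢y pair with InT⇒onTollWalk x≢y (Equivalence.from (pair _) (inj₁ refl))
  ... | ε , _ = ⊥-elim (x≢y refl)
  ... | _◅_ {b = b} e w , toll , _
      with Equivalence.to (pair b) (onTollWalk⇒InT x≢y (e ◅ w , toll , there (head∈ w)))
  ...   | inj₁ refl = ⊥-elim (~-irrefl e)
  ...   | inj₂ refl = e

  P₃-middle : a ~ b → b ~ c → ¬ a ~ c → a ≢ c → InT G a c b
  P₃-middle {a} {b} {c} e₁ e₂ a≁c a≢c =
    onTollWalk⇒InT a≢c
      (e₁ ◅ e₂ ◅ ε , (onlyNeighbour⇒atMostOne only-a , onlyNeighbour⇒atMostOne only-c) , there (here refl))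
    where
    only-a : OnlyNeighbour a b (a ∷ b ∷ c ∷ [])
    only-a (here refl) a~a = ⊥-elim (~-irrefl a~a)
    only-a (there (here refl)) _ = refl
    only-a (there (there (here refl))) a~c = ⊥-elim (a≁c a~c)
    only-c : OnlyNeighbour c b (a ∷ b ∷ c ∷ [])
    only-c (here refl) c~a = ⊥-elim (a≁c (~-sym c~a))
    only-c (there (here refl)) _ = refl
    only-c (there (there (here refl))) c~c = ⊥-elim (~-irrefl c~c)

  P₄-middle : a ~ b → b ~ c → c ~ d → ¬ a ~ c → ¬ a ~ d → ¬ b ~ d → a ≢ d → InT G a d b × InT G a d c
  P₄-middle {a} {b} {c} {d} e₁ e₂ e₃ a≁c a≁d b≁d a≢d = on-P₄ (there (here refl)) , on-P₄ (there (there (here refl)))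
    where
    only-a : OnlyNeighbour a b (a ∷ b ∷ c ∷ d ∷ [])
    only-a (here refl) a~a = ⊥-elim (~-irrefl a~a)
    only-a (there (here refl)) _ = refl
    only-a (there (there (here refl))) a~c = ⊥-elim (a≁c a~c)
    only-a (there (there (there (here refl)))) a~d = ⊥-elim (a≁d a~d)
    only-d : OnlyNeighbour d c (a ∷ b ∷ c ∷ d ∷ [])
    only-d (here refl) d~a = ⊥-elim (a≁d (~-sym d~a))
    only-d (there (here refl)) d~b = ⊥-elim (b≁d (~-sym d~b))
    only-d (there (there (here refl))) _ = refl
    only-d (there (there (there (here refl)))) d~d = ⊥-elim (~-irrefl d~d)
    on-P₄ : x ∈ a ∷ b ∷ c ∷ d ∷ [] → InT G a d x
    on-P₄ x∈ = onTollWalk⇒InT a≢d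
      (e₁ ◅ e₂ ◅ e₃ ◅ ε , (onlyNeighbour⇒atMostOne only-a , onlyNeighbour⇒atMostOne only-d) , x∈)

  Geodesic : Walk a b → Set
  Geodesic {a} {b} w = (w′ : Walk a b) → length w ≤ length w′

  private
    ≰-suc-+ : ∀ m n → ¬ suc (m + n) ≤ n
    ≰-suc-+ m n = ℕₚ.≤⇒≯ (ℕₚ.m≤n+m n m)

  geodesic⇒induced : (w : Walk a b) → Geodesic w → Induced w
  geodesic⇒induced ε _ = tt
  geodesic⇒induced (_◅_ {a} {c} e w) geo = a∉w , only , geodesic⇒induced w (ℕₚ.≤-pred ∘ geo ∘ (e ◅_))
    where
    a∉w : a ∉ vertices w
    a∉w a∈ with splitAt w a∈
    ... | p , s , len-ps , _ = ≰-suc-+ (length p) (length s) (subst (λ n → suc n ≤ length s) (sym len-ps) (geo s))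
    only : OnlyNeighbour a c (vertices w)
    only d∈ a~d with splitAt w d∈
    ... | ε , _ = refl
    ... | _ ◅ p , s , len-ps , _ =
      ⊥-elim (≰-suc-+ (length p) (length s) (subst (_≤ length s) (sym len-ps) (ℕₚ.≤-pred (geo (a~d ◅ s)))))

  private
    walkOfLength? : ∀ m a b → Dec (Σ (Walk a b) λ w → length w ≡ m)
    walkOfLength? zero a b with a Fin.≟ b
    ... | yes refl = yes (ε , refl)
    ... | no a≢b = no λ { (ε , _) → a≢b refl }
    walkOfLength? (suc m) a b with Finₚ.any? (λ c → (a ~? c) ×-dec walkOfLength? m c b)
    ... | yes (c , e , w , refl) = yes (e ◅ w , refl)
    ... | no none = no λ { (e ◅ w , len≡) → none (_ , e , w , ℕₚ.suc-injective len≡) }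

    leastWitness : (P : ℕ → Set) → (∀ m → Dec (P m)) → ∀ {ℓ} → P ℓ → Σ ℕ λ m → P m × (∀ m′ → P m′ → m ≤ m′)
    leastWitness P P? {zero} p = 0 , p , λ _ _ → z≤n
    leastWitness P P? {suc ℓ} p with P? 0
    ... | yes p0 = 0 , p0 , λ _ _ → z≤n
    ... | no ¬p0 with leastWitness (P ∘ suc) (P? ∘ suc) p
    ...   | m , pm , least = suc m , pm , λ { zero p0 → ⊥-elim (¬p0 p0) ; (suc m′) pm′ → s≤s (least m′ pm′) }

  geodesic-exists : (w : Walk a b) → Σ (Walk a b) λ g → Geodesic g × length g ≤ length w
  geodesic-exists {a} {b} w with leastWitness _ (λ m → walkOfLength? m a b) (w , refl)
  ... | _ , (g , refl) , least = g , (λ w′ → least (length w′) (w′ , refl)) , least (length w) (w , refl)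

  induced-injective : (p : Walk a b) → Induced p → ∀ i j → lookup p i ≡ lookup p j → i ≡ j
  induced-injective ε _ zero zero _ = refl
  induced-injective (e ◅ p) _ zero zero _ = refl
  induced-injective (e ◅ p) (a∉p , _) zero (suc j) a≡ = ⊥-elim (a∉p (subst (_∈ vertices p) (sym a≡) (lookup-∈ p j)))
  induced-injective (e ◅ p) (a∉p , _) (suc i) zero ≡a = ⊥-elim (a∉p (subst (_∈ vertices p) ≡a (lookup-∈ p i)))
  induced-injective (e ◅ p) (_ , _ , p-ind) (suc i) (suc j) eq = cong suc (induced-injective p p-ind i j eq)

  induced-chordless : (p : Walk a b) → Induced p → ∀ i j → lookup p i ~ lookup p j →
                      toℕ j ≡ suc (toℕ i) ⊎ toℕ i ≡ suc (toℕ j)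
  induced-chordless ε _ zero zero a~a = ⊥-elim (~-irrefl a~a)
  induced-chordless (e ◅ p) _ zero zero a~a = ⊥-elim (~-irrefl a~a)
  induced-chordless (e ◅ p) (_ , only , p-ind) zero (suc j) a~ =
    inj₁ (cong (suc ∘ toℕ)
      (induced-injective p p-ind j zero (trans (only (lookup-∈ p j) a~) (sym (lookup-head p)))))
  induced-chordless (e ◅ p) (_ , only , p-ind) (suc i) zero ~a =
    inj₂ (cong (suc ∘ toℕ)
      (induced-injective p p-ind i zero (trans (only (lookup-∈ p i) (~-sym ~a)) (sym (lookup-head p)))))
  induced-chordless (e ◅ p) (_ , _ , p-ind) (suc i) (suc j) i~j with induced-chordless p p-ind i j i~j
  ... | inj₁ j≡ = inj₁ (cong suc j≡)
  ... | inj₂ i≡ = inj₂ (cong suc i≡)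

  fromIsWalk-induced : ∀ k f (f-walk : IsWalk G k f) → IsInducedPath G k f → Induced (fromIsWalk k f f-walk)
  fromIsWalk-induced zero f f-walk _ = tt
  fromIsWalk-induced (suc k) f f-walk (f-inj , _ , chordless) =
    f0∉ , only , fromIsWalk-induced k (f ∘ suc) (f-walk ∘ suc) (Finₚ.suc-injective ∘ f-inj , f-walk ∘ suc , chordless′)
    where
    tail∈ : x ∈ vertices (fromIsWalk k (f ∘ suc) (f-walk ∘ suc)) → ∃ λ j → f (suc j) ≡ x
    tail∈ = ∈-fromIsWalk⁻ k (f ∘ suc) (f-walk ∘ suc)
    f0∉ : f zero ∉ vertices (fromIsWalk k (f ∘ suc) (f-walk ∘ suc))
    f0∉ f0∈ with tail∈ f0∈
    ... | j , eq with f-inj eq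
    ... | ()
    only : OnlyNeighbour (f zero) (f (suc zero)) (vertices (fromIsWalk k (f ∘ suc) (f-walk ∘ suc)))
    only d∈ f0~d with tail∈ d∈
    ... | j , refl with chordless zero (suc j) f0~d
    ... | inj₁ j≡0 = cong (f ∘ suc) (Finₚ.toℕ-injective {i = j} {j = zero} (ℕₚ.suc-injective j≡0))
    ... | inj₂ ()
    chordless′ : ∀ i j → f (suc i) ~ f (suc j) → toℕ j ≡ suc (toℕ i) ⊎ toℕ i ≡ suc (toℕ j)
    chordless′ i j i~j with chordless (suc i) (suc j) i~j
    ... | inj₁ j≡ = inj₁ (ℕₚ.suc-injective j≡)
    ... | inj₂ i≡ = inj₂ (ℕₚ.suc-injective i≡)

  InducedPathsGeodesic : Set
  InducedPathsGeodesic = ∀ {a b} (p : Walk a b) → Induced p → Geodesic p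

  distanceHereditary⇔ : DistanceHereditary G ⇔ InducedPathsGeodesic
  distanceHereditary⇔ = mk⇔ to from
    where
    to : DistanceHereditary G → InducedPathsGeodesic
    to dh p p-ind w =
      dh (length p) (lookup p)
         ((λ {i} {j} → induced-injective p p-ind i j) , lookup-isWalk p , induced-chordless p p-ind)
         (length w) (lookup w) (lookup-isWalk w)
         (trans (lookup-head w) (sym (lookup-head p))) (trans (lookup-last w) (sym (lookup-last p)))
    from : InducedPathsGeodesic → DistanceHereditary G
    from geo k p p-path@(_ , p-walk , _) ℓ w w-walk w₀≡ wℓ≡ =
      subst₂ _≤_ (length-fromIsWalk k p p-walk) (trans (length-subst₂ w₀≡ wℓ≡ _) (length-fromIsWalk ℓ w w-walk))
        (geo (fromIsWalk k p p-walk) (fromIsWalk-induced k p p-walk p-path)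
             (subst₂ Walk w₀≡ wℓ≡ (fromIsWalk ℓ w w-walk)))
      where
      length-subst₂ : ∀ {a a′ b b′} (p : a ≡ a′) (q : b ≡ b′) (w : Walk a b) → length (subst₂ Walk p q w) ≡ length w
      length-subst₂ refl refl w = refl

  Detour : V G → Walk y z → Set
  Detour {y} {z} x ω = x ∉ vertices ω × (∀ {d} → d ∈ vertices ω → x ~ d → d ≡ y ⊎ d ≡ z)

  cone : V G → (p : Walk a b) → Fin (2 + length p) → V G
  cone x p zero = x
  cone x p (suc i) = lookup p i

  lookup-consecutive : (w : Walk a b) (i j : Fin (suc (length w))) → toℕ j ≡ suc (toℕ i) → lookup w i ~ lookup w j
  lookup-consecutive ε zero zero ()
  lookup-consecutive (e ◅ w) zero zero ()
  lookup-consecutive (e ◅ w) (suc i) zero ()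
  lookup-consecutive (e ◅ w) zero (suc j) j≡ with Finₚ.toℕ-injective {i = j} {j = zero} (ℕₚ.suc-injective j≡)
  ... | refl = subst (_ ~_) (sym (lookup-head w)) e
  lookup-consecutive (e ◅ w) (suc i) (suc j) j≡ = lookup-consecutive w i j (ℕₚ.suc-injective j≡)

  private
    suc-mod : ∀ m t → t < suc m → (suc t < suc m × suc t % suc m ≡ suc t) ⊎ (suc t ≡ suc m × suc t % suc m ≡ 0)
    suc-mod m t t<n with ℕₚ.m≤n⇒m<n∨m≡n t<n
    ... | inj₁ lt = inj₁ (lt , m<n⇒m%n≡m lt)
    ... | inj₂ eq = inj₂ (eq , trans (cong (_% suc m) eq) (n%n≡0 (suc m)))

    no-wrap : ∀ {m} (i j : Fin (suc m)) → toℕ j ≡ suc (toℕ i) → toℕ j ≡ suc (toℕ i) % suc m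
    no-wrap {m} i j j≡ = trans j≡ (sym (m<n⇒m%n≡m (subst (_< suc m) j≡ (Finₚ.toℕ<n j))))

    cyclic-successor : ∀ {m} (i j : Fin (suc m)) → toℕ j ≡ suc (toℕ i) % suc m → toℕ j ≡ suc (toℕ i) ⊎ toℕ j ≡ 0
    cyclic-successor {m} i j j≡ with suc-mod m (toℕ i) (Finₚ.toℕ<n i)
    ... | inj₁ (_ , eq) = inj₁ (trans j≡ eq)
    ... | inj₂ (_ , eq) = inj₂ (trans j≡ eq)

  hole : (e₁ : y ~ a) (e₂ : a ~ b) (r : Walk b z) → Induced (e₁ ◅ e₂ ◅ r) → x ~ y → x ~ z →
         Detour x (e₁ ◅ e₂ ◅ r) → IsInducedCycle G (length r) (cone x (e₁ ◅ e₂ ◅ r))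
  hole {y} {z = z} {x} e₁ e₂ r p-ind x~y x~z (x∉p , x-nbrs) = injective , consecutive , chordless
    where
    p = e₁ ◅ e₂ ◅ r
    k = length r
    cyc = cone x p
    p-inj = induced-injective p p-ind

    at-end : ∀ i → toℕ i ≡ 2 + k → lookup p i ≡ z
    at-end i i≡ =
      trans (cong (lookup p) (Finₚ.toℕ-injective (trans i≡ (sym (Finₚ.toℕ-fromℕ (2 + k)))))) (lookup-last p)

    wraps : ∀ j → lookup p j ≡ z → 0 ≡ suc (toℕ (suc j)) % (4 + k)
    wraps j ≡z = sym (trans (cong (λ t → suc (suc t) % (4 + k)) j≡) (n%n≡0 (4 + k)))
      where
      j≡ : toℕ j ≡ 2 + k
      j≡ = trans (cong toℕ (p-inj j (fromℕ (2 + k)) (trans ≡z (sym (lookup-last p))))) (Finₚ.toℕ-fromℕ (2 + k))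

    injective : ∀ {i j} → cyc i ≡ cyc j → i ≡ j
    injective {zero} {zero} _ = refl
    injective {zero} {suc j} x≡ = ⊥-elim (x∉p (subst (_∈ vertices p) (sym x≡) (lookup-∈ p j)))
    injective {suc i} {zero} ≡x = ⊥-elim (x∉p (subst (_∈ vertices p) ≡x (lookup-∈ p i)))
    injective {suc i} {suc j} eq = cong suc (p-inj i j eq)

    consecutive : ∀ i j → toℕ j ≡ suc (toℕ i) % (4 + k) → cyc i ~ cyc j
    consecutive i j j≡ with suc-mod (3 + k) (toℕ i) (Finₚ.toℕ<n i)
    consecutive zero zero j≡ | inj₁ (_ , eq) with trans j≡ eq
    ... | ()
    consecutive zero (suc j) j≡ | inj₁ (_ , eq)
      with Finₚ.toℕ-injective {i = j} {j = zero} (ℕₚ.suc-injective (trans j≡ eq))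
    ... | refl = x~y
    consecutive (suc i) zero j≡ | inj₁ (_ , eq) with trans j≡ eq
    ... | ()
    consecutive (suc i) (suc j) j≡ | inj₁ (_ , eq) = lookup-consecutive p i j (ℕₚ.suc-injective (trans j≡ eq))
    consecutive zero j j≡ | inj₂ (() , _)
    consecutive (suc i) (suc j) j≡ | inj₂ (_ , eq) with trans j≡ eq
    ... | ()
    consecutive (suc i) zero _ | inj₂ (i≡ , _) =
      subst (_~ x) (sym (at-end i (ℕₚ.suc-injective (ℕₚ.suc-injective i≡)))) (~-sym x~z)

    chordless : ∀ i j → cyc i ~ cyc j → toℕ j ≡ suc (toℕ i) % (4 + k) ⊎ toℕ i ≡ suc (toℕ j) % (4 + k)
    chordless zero zero x~x = ⊥-elim (~-irrefl x~x)
    chordless zero (suc j) x~ with x-nbrs (lookup-∈ p j) x~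
    ... | inj₂ ≡z = inj₂ (wraps j ≡z)
    ... | inj₁ ≡y with p-inj j zero ≡y
    ...   | refl = inj₁ refl
    chordless (suc i) zero ~x = swap (chordless zero (suc i) (~-sym ~x))
    chordless (suc i) (suc j) i~j with induced-chordless p p-ind i j i~j
    ... | inj₁ j≡ = inj₁ (no-wrap (suc i) (suc j) (cong suc j≡))
    ... | inj₂ i≡ = inj₂ (no-wrap (suc j) (suc i) (cong suc i≡))

  chordal-detour⇒adjacent : Chordal G → x ~ y → x ~ z → y ≢ z → (ω : Walk y z) → Detour x ω → y ~ z
  chordal-detour⇒adjacent {x} {y} {z} ch x~y x~z y≢z ω (x∉ω , x-nbrs) with y ~? z
  ... | yes y~z = y~z
  ... | no y≁z with shortcut ω
  ...   | ε , _ = ⊥-elim (y≢z refl)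
  ...   | e ◅ ε , _ = ⊥-elim (y≁z e)
  ...   | e₁ ◅ e₂ ◅ r , p-ind , p⊆ =
    ⊥-elim (ch (length r) (cone x (e₁ ◅ e₂ ◅ r)) (hole e₁ e₂ r p-ind x~y x~z (x∉ω ∘ p⊆ , x-nbrs ∘ p⊆)))

  chordal-converging⇒adjacent : Chordal G → (e : x ~ y) (f : x ~ z) (p : Walk y t) (q : Walk z t) →
                                 Induced (e ◅ p) → Induced (f ◅ q) → y ≢ z → y ~ z
  chordal-converging⇒adjacent {x} {y} {z} ch e f p q (x∉p , only-p , _) (x∉q , only-q , _) y≢z =
    chordal-detour⇒adjacent ch e f y≢z (p ◅◅ reverse q) (x∉ , x-nbrs)
    where
    x∉ : x ∉ vertices (p ◅◅ reverse q)
    x∉ x∈ with ∈-◅◅⁻ p (reverse q) x∈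
    ... | inj₁ x∈p = x∉p x∈p
    ... | inj₂ x∈q = x∉q (∈-reverse⁻ q x∈q)
    x-nbrs : ∀ {d} → d ∈ vertices (p ◅◅ reverse q) → x ~ d → d ≡ y ⊎ d ≡ z
    x-nbrs d∈ x~d with ∈-◅◅⁻ p (reverse q) d∈
    ... | inj₁ d∈p = inj₁ (only-p d∈p x~d)
    ... | inj₂ d∈q = inj₂ (only-q (∈-reverse⁻ q d∈q) x~d)

  chordal-neighbours-adjacent : Chordal G → OnTollWalk x v y → OnTollWalk x v z →
                                x ~ y → x ~ z → y ≢ z → x ≢ v → y ~ z
  chordal-neighbours-adjacent ch (p , (one-p , _) , y∈) (q , (one-q , _) , z∈) x~y x~z y≢z x≢v
    with inducedSuffix p one-p y∈ x~y x≢v | inducedSuffix q one-q z∈ x~z x≢v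
  ... | p′ , p′-ind , _ | q′ , q′-ind , _ = chordal-converging⇒adjacent ch x~y x~z p′ q′ p′-ind q′-ind y≢z

  -- Ptolemaic graphs satisfy (JC) and (pt)

  -- If x's only neighbour on a walk w from x is y, then x separates the start of an
  -- induced path ending in x y from the rest of w: otherwise there is a hole through y.
  chordal-separates : Chordal G → x ~ y → (w : Walk x v) → AtMostOneNeighbour x (vertices w) → y ∈ vertices w →
                      (p : Walk a x) → y ∉ vertices p → OnlyNeighbour y x (vertices p) →
                      a ≢ x → b ∈ vertices w → b ≢ x → ¬ Near a b
  chordal-separates {x = x} {y} {a = a} ch x~y w one-x y∈w p y∉p only-y a≢x b∈w b≢x near with splitAt w b∈w
  ... | ε , _ = b≢x refl
  ... | e ◅ s , _ , _ , s⊆ , _ with one-x (s⊆ (there (head∈ s))) y∈w e x~y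
  ... | refl with inducedSuffix (e ◅ s) (atMostOne-⊆ s⊆ one-x) (there (head∈ s)) x~y (b≢x ∘ sym)
  ...   | ε , _ = near-y near
    where
    near-y : ¬ Near a y
    near-y (inj₁ refl) = y∉p (head∈ p)
    near-y (inj₂ a~y) = a≢x (only-y (head∈ p) (~-sym a~y))
  ...   | _◅_ {b = y⁺} y~y⁺ q , (x∉ , only-x , y∉q , only-y⁺ , _) , _ with near⇒walk near
  ...     | l , l-ends = y∉q (subst (_∈ vertices q) y⁺≡y (head∈ q))
    where
    ω = q ◅◅ l ◅◅ p
    ω⊆ : d ∈ vertices ω → d ∈ vertices q ⊎ d ∈ vertices p
    ω⊆ d∈ with ∈-◅◅⁻ q (l ◅◅ p) d∈
    ... | inj₁ d∈q = inj₁ d∈q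
    ... | inj₂ d∈lp with ∈-◅◅⁻ l p d∈lp
    ...   | inj₂ d∈p = inj₂ d∈p
    ...   | inj₁ d∈l with l-ends d∈l
    ...     | inj₁ refl = inj₁ (last∈ q)
    ...     | inj₂ refl = inj₂ (head∈ p)
    y∉ω : y ∉ vertices ω
    y∉ω y∈ with ω⊆ y∈
    ... | inj₁ y∈q = y∉q y∈q
    ... | inj₂ y∈p = y∉p y∈p
    y-nbrs : ∀ {d} → d ∈ vertices ω → y ~ d → d ≡ y⁺ ⊎ d ≡ x
    y-nbrs d∈ y~d with ω⊆ d∈
    ... | inj₁ d∈q = inj₁ (only-y⁺ d∈q y~d)
    ... | inj₂ d∈p = inj₂ (only-y d∈p y~d)
    y⁺~x : y⁺ ~ x
    y⁺~x = chordal-detour⇒adjacent ch y~y⁺ (~-sym x~y) (λ { refl → x∉ (there (head∈ q)) }) ω (y∉ω , y-nbrs)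
    y⁺≡y : y⁺ ≡ y
    y⁺≡y = only-x (there (head∈ q)) (~-sym y⁺~x)

  chordal⇒JC : Chordal G → u ≢ x → u ≢ y → y ≢ v → x ≢ v → x ~ y →
               OnTollWalk u y x → OnTollWalk x v y → OnTollWalk u v x
  chordal⇒JC {u} {x} {y} {v} ch u≢x u≢y y≢v x≢v x~y (w₁ , (one-u , one-y) , x∈w₁) (w₂ , (one-x , one-v) , y∈w₂)
    with inducedPrefix w₁ one-y x∈w₁ x~y (u≢y ∘ sym)
       | inducedPrefix (reverse w₂) (atMostOne-⊆ (∈-reverse⁻ w₂) one-x) (∈-reverse⁺ w₂ y∈w₂) (~-sym x~y) x≢v
       | splitAt w₁ x∈w₁
  ... | p , (_ , y∉p , only-y) , _ | p′ , (_ , x∉p′ , only-x) , _ | s , _ , _ , s⊆ , _ =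
    s ◅◅ w₂ , (one-u′ , one-v′) , ∈-◅◅⁺ʳ s w₂ (head∈ w₂)
    where
    u-nbr∈w₁ : ∀ {c} → c ∈ vertices (s ◅◅ w₂) → u ~ c → c ∈ vertices w₁
    u-nbr∈w₁ {c} c∈ u~c with ∈-◅◅⁻ s w₂ c∈
    ... | inj₁ c∈s = s⊆ c∈s
    ... | inj₂ c∈w₂ with c Fin.≟ x
    ...   | yes refl = x∈w₁
    ...   | no c≢x = ⊥-elim (chordal-separates ch x~y w₂ one-x y∈w₂ p y∉p only-y u≢x c∈w₂ c≢x (inj₂ u~c))
    v-nbr∈w₂ : ∀ {c} → c ∈ vertices (s ◅◅ w₂) → v ~ c → c ∈ vertices w₂
    v-nbr∈w₂ {c} c∈ v~c with ∈-◅◅⁻ s w₂ c∈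
    ... | inj₂ c∈w₂ = c∈w₂
    ... | inj₁ c∈s with c Fin.≟ y
    ...   | yes refl = y∈w₂
    ...   | no c≢y = ⊥-elim (chordal-separates ch (~-sym x~y) (reverse w₁) (atMostOne-⊆ (∈-reverse⁻ w₁) one-y)
                               (∈-reverse⁺ w₁ x∈w₁) p′ x∉p′ only-x (y≢v ∘ sym) (∈-reverse⁺ w₁ (s⊆ c∈s)) c≢y
                               (inj₂ v~c))
    one-u′ : AtMostOneNeighbour u (vertices (s ◅◅ w₂))
    one-u′ c∈ d∈ u~c u~d = one-u (u-nbr∈w₁ c∈ u~c) (u-nbr∈w₁ d∈ u~d) u~c u~d
    one-v′ : AtMostOneNeighbour v (vertices (s ◅◅ w₂))
    one-v′ c∈ d∈ v~c v~d = one-v (v-nbr∈w₂ c∈ v~c) (v-nbr∈w₂ d∈ v~d) v~c v~d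

  ptolemaic⇒¬tollTriangle : Ptolemaic G → u ≢ y → x ≢ v → x ~ y → x ~ z → y ~ z →
                            OnTollWalk u y x → OnTollWalk u y z → OnTollWalk x v y → OnTollWalk x v z → ⊥
  ptolemaic⇒¬tollTriangle {u} {y} {x} {v} (ch , dh) u≢y x≢v x~y x~z y~z
    (w₁ , (_ , one-y₁) , x∈w₁) (w₁′ , (_ , one-y₁′) , z∈w₁′) (w₂ , (one-x₂ , _) , y∈w₂) (w₂′ , (one-x₂′ , _) , z∈w₂′)
    with inducedPrefix w₁ one-y₁ x∈w₁ x~y (u≢y ∘ sym) | inducedPrefix w₁′ one-y₁′ z∈w₁′ (~-sym y~z) (u≢y ∘ sym)
       | inducedSuffix w₂ one-x₂ y∈w₂ x~y x≢v | inducedSuffix w₂′ one-x₂′ z∈w₂′ x~z x≢v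
  ... | p , p▻y@(p-ind , y∉p , only-y) , _ | p′ , p′▻y , _ | q , xq-ind@(x∉q , _) , q⊆ | q′ , xq′-ind , _ =
    ℕₚ.≤⇒≯ (ℕₚ.+-mono-≤ p′≤p q′≤q) (subst (_≤ length p′ + length q′) (ℕₚ.+-suc (length p) (length q)) through-edge)
    where
    geodesic = Equivalence.to distanceHereditary⇔ dh
    cross : ∀ {s t} → s ∈ vertices p → t ∈ vertices (x~y ◅ q) → Near s t → s ≡ x ⊎ t ≡ x
    cross _ (here refl) _ = inj₂ refl
    cross {s} s∈ (there t∈q) near with s Fin.≟ x
    ... | yes s≡x = inj₁ s≡x
    ... | no s≢x with splitAt p s∈
    ...   | _ , r , _ , _ , r⊆ =
      ⊥-elim (chordal-separates ch x~y w₂ one-x₂ y∈w₂ r (y∉p ∘ r⊆) (only-y ∘ r⊆) s≢x (q⊆ t∈q)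
                                (λ { refl → x∉q t∈q }) near)
    p′≤p : length p′ ≤ length p
    p′≤p = ℕₚ.+-cancelʳ-≤ 1 _ _
             (subst₂ _≤_ (length-◅◅ p′ (~-sym y~z ◅ ε)) (length-◅◅ p (x~y ◅ ε))
               (geodesic _ (induced▻⇒induced p′ (~-sym y~z) p′▻y) (p ◅◅ x~y ◅ ε)))
    q′≤q : length q′ ≤ length q
    q′≤q = ℕₚ.≤-pred (geodesic (x~z ◅ q′) xq′-ind (x~y ◅ q))
    through-edge : length p + suc (length q) ≤ length p′ + length q′
    through-edge = subst₂ _≤_ (length-◅◅ p (x~y ◅ q)) (length-◅◅ p′ q′)
                     (geodesic _ (induced-◅◅ p (x~y ◅ q) p-ind xq-ind cross) (p′ ◅◅ q′))

  ptolemaic⇒JC : Ptolemaic G → Axiom-JC G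
  ptolemaic⇒JC (ch , _) u x y v u≢x u≢y u≢v x≢y x≢v y≢v x∈T y∈T pair =
    onTollWalk⇒InT u≢v (chordal⇒JC ch u≢x u≢y y≢v x≢v (isPair⇒adj x≢y pair)
                                     (InT⇒onTollWalk u≢y x∈T) (InT⇒onTollWalk x≢v y∈T))

  ptolemaic⇒pt : Ptolemaic G → Axiom-pt G
  ptolemaic⇒pt ptol@(ch , _) u x y z v _ u≢y _ _ x≢y x≢z x≢v y≢z _ _ x∈T₁ z∈T₁ y∈T₂ z∈T₂ pair =
    x≁z ∘ isPair⇒adj x≢z , y≁z ∘ isPair⇒adj y≢z
    where
    x~y = isPair⇒adj x≢y pair
    x∈uy = InT⇒onTollWalk u≢y x∈T₁
    z∈uy = InT⇒onTollWalk u≢y z∈T₁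
    y∈xv = InT⇒onTollWalk x≢v y∈T₂
    z∈xv = InT⇒onTollWalk x≢v z∈T₂
    triangle : x ~ z → y ~ z → ⊥
    triangle x~z y~z = ptolemaic⇒¬tollTriangle ptol u≢y x≢v x~y x~z y~z x∈uy z∈uy y∈xv z∈xv
    x≁z : ¬ x ~ z
    x≁z x~z = triangle x~z (chordal-neighbours-adjacent ch y∈xv z∈xv x~y x~z y≢z x≢v)
    y≁z : ¬ y ~ z
    y≁z y~z = triangle (chordal-neighbours-adjacent ch (onTollWalk-sym x∈uy) (onTollWalk-sym z∈uy)
                                                    (~-sym x~y) y~z x≢z (u≢y ∘ sym)) y~z

  -- (JC) and (pt) force Ptolemaic graphs

  private
    ∈⇒≢ : x ∉ xs → y ∈ xs → x ≢ y
    ∈⇒≢ x∉ y∈ refl = x∉ y∈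

  module InducedCycle {k} {c : Fin (4 + k) → V G} (hole : IsInducedCycle G k c) where

    distinct : ∀ {i j} → toℕ i ≢ toℕ j → c i ≢ c j
    distinct i≢j eq = i≢j (cong toℕ (proj₁ hole eq))

    adjacent : ∀ i j → toℕ j ≡ suc (toℕ i) % (4 + k) → c i ~ c j
    adjacent = proj₁ (proj₂ hole)

    nonadjacent : ∀ i j → toℕ j ≢ suc (toℕ i) % (4 + k) → toℕ i ≢ suc (toℕ j) % (4 + k) → ¬ c i ~ c j
    nonadjacent i j ≢₁ ≢₂ i~j with proj₂ (proj₂ hole) i j i~j
    ... | inj₁ eq = ≢₁ eq
    ... | inj₂ eq = ≢₂ eq

    arc-walk : IsWalk G (2 + k) (c ∘ suc)
    arc-walk i = adjacent (suc (inject₁ i)) (suc (suc i))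
                   (no-wrap (suc (inject₁ i)) (suc (suc i)) (cong (2 +_) (sym (Finₚ.toℕ-inject₁ i))))

    arc-induced : Induced (fromIsWalk (2 + k) (c ∘ suc) arc-walk)
    arc-induced = fromIsWalk-induced (2 + k) (c ∘ suc) arc-walk
                    (Finₚ.suc-injective ∘ proj₁ hole , arc-walk , chordless)
      where
      forward : ∀ (i j : Fin (3 + k)) → toℕ (suc j) ≡ suc (toℕ (suc i)) % (4 + k) → toℕ j ≡ suc (toℕ i)
      forward i j j≡ with cyclic-successor (suc i) (suc j) j≡
      ... | inj₁ eq = ℕₚ.suc-injective eq
      chordless : ∀ i j → c (suc i) ~ c (suc j) → toℕ j ≡ suc (toℕ i) ⊎ toℕ i ≡ suc (toℕ j)
      chordless i j i~j with proj₂ (proj₂ hole) (suc i) (suc j) i~j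
      ... | inj₁ j≡ = inj₁ (forward i j j≡)
      ... | inj₂ i≡ = inj₂ (forward j i i≡)

  JC⇒no-C₄ : Axiom-JC G → (c : Fin 4 → V G) → ¬ IsInducedCycle G 0 c
  JC⇒no-C₄ jc c hole with Equivalence.to (adj⇒isPair (~-sym (adjacent c₂ c₃ refl)) (c c₀)) c₀∈T₃₂
    where
    open InducedCycle hole
    c₀ c₁ c₂ c₃ : Fin 4
    c₀ = zero
    c₁ = suc zero
    c₂ = suc (suc zero)
    c₃ = suc (suc (suc zero))
    c₀∈T₃₂ : InT G (c c₃) (c c₂) (c c₀)
    c₀∈T₃₂ = jc (c c₃) (c c₀) (c c₁) (c c₂) (distinct λ ()) (distinct λ ()) (distinct λ ()) (distinct λ ())
                (distinct λ ()) (distinct λ ())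
                (P₃-middle (adjacent c₃ c₀ refl) (adjacent c₀ c₁ refl)
                           (nonadjacent c₃ c₁ (λ ()) (λ ())) (distinct λ ()))
                (P₃-middle (adjacent c₀ c₁ refl) (adjacent c₁ c₂ refl)
                           (nonadjacent c₀ c₂ (λ ()) (λ ())) (distinct λ ()))
                (adj⇒isPair (adjacent c₀ c₁ refl))
  ... | inj₁ eq = InducedCycle.distinct hole (λ ()) eq
  ... | inj₂ eq = InducedCycle.distinct hole (λ ()) eq

  pt⇒no-long-hole : Axiom-pt G → ∀ k (c : Fin (5 + k) → V G) → ¬ IsInducedCycle G (suc k) c
  pt⇒no-long-hole pt k c hole = proj₁ conclusion (adj⇒isPair c₁~c₂)
    where
    open InducedCycle hole
    c₀ c₁ c₂ c₃ cₗ : Fin (5 + k)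
    c₀ = zero
    c₁ = suc zero
    c₂ = suc (suc zero)
    c₃ = suc (suc (suc zero))
    cₗ = fromℕ (4 + k)
    cₗ-wraps : suc (toℕ cₗ) % (5 + k) ≡ 0
    cₗ-wraps = trans (cong (λ t → suc t % (5 + k)) (Finₚ.toℕ-fromℕ (4 + k))) (n%n≡0 (5 + k))
    c₁~c₂ = adjacent c₁ c₂ refl
    c₁~c₀ = ~-sym (adjacent c₀ c₁ refl)
    arc = fromIsWalk (3 + k) (c ∘ suc) arc-walk
    c₁,c₂∈T₃₀ : InT G (c c₃) (c c₀) (c c₂) × InT G (c c₃) (c c₀) (c c₁)
    c₁,c₂∈T₃₀ = P₄-middle (~-sym (adjacent c₂ c₃ refl)) (~-sym c₁~c₂) c₁~c₀
                  (nonadjacent c₃ c₁ (λ ()) (λ ())) (nonadjacent c₃ c₀ (λ ()) (λ ())) (nonadjacent c₂ c₀ (λ ()) (λ ()))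
                  (distinct λ ())
    c₀∈T₁ₗ : InT G (c c₁) (c cₗ) (c c₀)
    c₀∈T₁ₗ = P₃-middle c₁~c₀ (~-sym (adjacent cₗ c₀ (sym cₗ-wraps)))
               (nonadjacent c₁ cₗ (λ ()) (λ eq → case trans eq cₗ-wraps of λ ())) (distinct λ ())
    c₂∈T₁ₗ : InT G (c c₁) (c cₗ) (c c₂)
    c₂∈T₁ₗ = onTollWalk⇒InT (distinct λ ())
               (arc , induced⇒toll arc arc-induced , ∈-fromIsWalk⁺ (3 + k) (c ∘ suc) arc-walk (suc zero))
    conclusion = pt (c c₃) (c c₁) (c c₀) (c c₂) (c cₗ)
                   (distinct λ ()) (distinct λ ()) (distinct λ ()) (distinct λ ()) (distinct λ ())
                   (distinct λ ()) (distinct λ ()) (distinct λ ()) (distinct λ ()) (distinct λ ())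
                   (proj₂ c₁,c₂∈T₃₀) (proj₁ c₁,c₂∈T₃₀) c₀∈T₁ₗ c₂∈T₁ₗ (adj⇒isPair c₁~c₀)

  axioms⇒chordal : Axiom-JC G → Axiom-pt G → Chordal G
  axioms⇒chordal jc pt zero = JC⇒no-C₄ jc
  axioms⇒chordal jc pt (suc k) = pt⇒no-long-hole pt k

  pt⇒no-shortcut : Chordal G → Axiom-pt G → (e₀ : a ~ b) (e₁ : b ~ c) (e₂ : c ~ d) (r : Walk d t) →
                   Induced (e₀ ◅ e₁ ◅ e₂ ◅ r) → Geodesic (e₁ ◅ e₂ ◅ r) →
                   (w : Walk a t) → length w < length (e₀ ◅ e₁ ◅ e₂ ◅ r) → ⊥
  pt⇒no-shortcut {a} {b} {c} {t = t} ch pt e₀ e₁ e₂ r p-ind@(a∉ , _) tail-geo w w< with geodesic-exists w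
  ... | ε , _ = a∉ (last∈ (e₁ ◅ e₂ ◅ r))
  ... | _◅_ {b = q} e₀′ g , g-geo , g≤w = proj₁ conclusion (adj⇒isPair b~q)
    where
    tail = e₁ ◅ e₂ ◅ r
    tail-ind = proj₂ (proj₂ p-ind)
    only-a = proj₁ (proj₂ p-ind)
    b∉ = proj₁ tail-ind
    c∉ = proj₁ (proj₂ (proj₂ tail-ind))
    g-short : suc (length g) ≤ length tail
    g-short = ℕₚ.≤-pred (ℕₚ.≤-trans (s≤s g≤w) w<)
    b≢q : b ≢ q
    b≢q refl = ℕₚ.≤⇒≯ (tail-geo g) g-short
    a≁c : ¬ a ~ c
    a≁c a~c = b∉ (here (sym (only-a (there (here refl)) a~c)))
    b~q : b ~ q
    b~q = chordal-converging⇒adjacent ch e₀ e₀′ tail g p-ind (geodesic⇒induced (e₀′ ◅ g) g-geo) b≢q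
    bq-ind : Induced (b~q ◅ g)
    bq-ind = geodesic⇒induced (b~q ◅ g) (λ w′ → ℕₚ.≤-trans g-short (tail-geo w′))
    c~q : c ~ q
    c~q = chordal-converging⇒adjacent ch e₁ b~q (e₂ ◅ r) g tail-ind bq-ind (λ { refl → a≁c e₀′ })
    a≢t : a ≢ t
    a≢t = ∈⇒≢ a∉ (last∈ tail)
    b≢t : b ≢ t
    b≢t = ∈⇒≢ b∉ (last∈ (e₂ ◅ r))
    conclusion = pt a b c q t
                   (~⇒≢ e₀) (∈⇒≢ a∉ (there (here refl))) (~⇒≢ e₀′) a≢t
                   (~⇒≢ e₁) (~⇒≢ b~q) b≢t
                   (~⇒≢ c~q) (∈⇒≢ c∉ (last∈ r))
                   (λ { refl → b≢t (sym (only-a (last∈ tail) e₀′)) })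
                   (P₃-middle e₀ e₁ a≁c (∈⇒≢ a∉ (there (here refl))))
                   (P₃-middle e₀′ (~-sym c~q) a≁c (∈⇒≢ a∉ (there (here refl))))
                   (onTollWalk⇒InT b≢t (tail , induced⇒toll tail tail-ind , there (here refl)))
                   (onTollWalk⇒InT b≢t (b~q ◅ g , induced⇒toll (b~q ◅ g) bq-ind , there (head∈ g)))
                   (adj⇒isPair e₁)

  axioms⇒inducedPathsGeodesic : Chordal G → Axiom-pt G → InducedPathsGeodesic
  axioms⇒inducedPathsGeodesic ch pt ε _ _ = z≤n
  axioms⇒inducedPathsGeodesic ch pt (e ◅ ε) (a∉ , _) ε = ⊥-elim (a∉ (here refl))
  axioms⇒inducedPathsGeodesic ch pt (e ◅ ε) _ (_ ◅ _) = s≤s z≤n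
  axioms⇒inducedPathsGeodesic ch pt (e₀ ◅ e₁ ◅ ε) (a∉ , _) ε = ⊥-elim (a∉ (there (here refl)))
  axioms⇒inducedPathsGeodesic ch pt (e₀ ◅ e₁ ◅ ε) (_ , only , b∉ , _) (a~c ◅ ε) =
    ⊥-elim (b∉ (here (sym (only (there (here refl)) a~c))))
  axioms⇒inducedPathsGeodesic ch pt (e₀ ◅ e₁ ◅ ε) _ (_ ◅ _ ◅ _) = s≤s (s≤s z≤n)
  axioms⇒inducedPathsGeodesic ch pt (e₀ ◅ e₁ ◅ e₂ ◅ r) p-ind@(_ , _ , tail-ind) w =
    ℕₚ.≮⇒≥ (pt⇒no-shortcut ch pt e₀ e₁ e₂ r p-ind (axioms⇒inducedPathsGeodesic ch pt (e₁ ◅ e₂ ◅ r) tail-ind) w)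

  axioms⇒ptolemaic : Axiom-JC G → Axiom-pt G → Ptolemaic G
  axioms⇒ptolemaic jc pt = chordal , Equivalence.from distanceHereditary⇔ (axioms⇒inducedPathsGeodesic chordal pt)
    where
    chordal = axioms⇒chordal jc pt

theorem11 : (G : Graph) → (Axiom-JC G × Axiom-pt G) ⇔ Ptolemaic G
theorem11 G = mk⇔ (λ (jc , pt) → axioms⇒ptolemaic G jc pt) (λ ptol → ptolemaic⇒JC G ptol , ptolemaic⇒pt G ptol)
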